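{- The group $\Gamma(K_{3,6})$ is infinite.
   Context: $K_{3,6}$ is the complete bipartite graph with parts of sizes $3$ and $6$. For a graph $G$ with $E(v)$ the set of edges at $v$, $\Gamma(G)$ is the group generated by $\{x_e:e\in E(G)\}$ with relations $x_e^2=1$, $[x_e,x_{e'}]=1$ whenever $e,e'\in E(v)$ for some vertex $v$, and $\prod_{e\in E(v)}x_e=1$ for each vertex $v$. -}

module Defs where

open import Data.Nat using (ℕ)
open import Data.Fin using (Fin)
open import Data.Bool using (Bool; true; false; not)
open import Data.Product using (_×_; _,_)
open import Data.Sum using (_⊎_; inj₁; inj₂)
open import Data.List using (List; []; _∷_; _++_; map)
open import Data.List.Membership.Propositional using (_∈_)
open import Data.List.Base using (tabulate)

Vertex : Set
Vertex = Fin 3 ⊎ Fin 6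

Edge : Set
Edge = Fin 3 × Fin 6

allFin : (n : ℕ) → List (Fin n)
allFin n = tabulate {n = n} (λ i → i)

edgesAt : Vertex → List Edge
edgesAt (inj₁ i) = map (λ j → (i , j)) (allFin 6)
edgesAt (inj₂ j) = map (λ i → (i , j)) (allFin 3)

Letter : Set
Letter = Edge × Bool

Word : Set
Word = List Letter

gen : Edge → Letter
gen e = (e , true)

inv : Edge → Letter
inv e = (e , false)

invL : Letter → Letter
invL (e , b) = (e , not b)

data Relator : Word → Set where
  square : ∀ e → Relator (gen e ∷ gen e ∷ [])
  commute : ∀ v e e' → e ∈ edgesAt v → e' ∈ edgesAt v →
            Relator (gen e ∷ gen e' ∷ inv e ∷ inv e' ∷ [])
  vertex : ∀ v → Relator (map gen (edgesAt v))

-- equality in the presented group Γ(K_{3,6}) = F(E) / ⟨⟨relators⟩⟩: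
-- the congruence on words generated by free cancellation and
-- deletion of relators
infix 4 _≈_
data _≈_ : Word → Word → Set where
  ≈-refl   : ∀ {w} → w ≈ w
  ≈-sym    : ∀ {w w'} → w ≈ w' → w' ≈ w
  ≈-trans  : ∀ {w w' w''} → w ≈ w' → w' ≈ w'' → w ≈ w''
  cancel   : ∀ u a v → u ++ a ∷ invL a ∷ v ≈ u ++ v
  relator  : ∀ u r v → Relator r → u ++ r ++ v ≈ u ++ v

module Submission where

-- Γ(K_{3,6}) acts on ℤ⁴ by maps x ↦ (±x_{π(k)} + c_k)ₖ, with every generator acting by an
-- involution. Such maps have a finite description that is closed under composition, so
-- that every defining relator acts trivially can be checked by computation. The word
-- h = x₀₀ x₁₁ x₀₄ x₂₁ acts as the translation by (−1, 0, 1, 0); hence the powers of h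
-- act by pairwise distinct translations and are pairwise distinct in Γ(K_{3,6}).

open import Defs
open import Data.Fin using (Fin)
open import Data.Fin.Patterns
open import Data.Fin.Properties using (all?)
import Data.Fin.Properties as Fin
open import Data.Integer using (ℤ; _+_; 0ℤ; 1ℤ; -1ℤ)
import Data.Integer as ℤ
import Data.Integer.Properties as ℤ
open import Data.List using ([]; _∷_; _++_; map)
open import Data.List.Relation.Unary.All as All using (All)
open import Data.Nat using (ℕ; zero; suc)
import Data.Nat.Properties as ℕ
open import Data.Product using (Σ; _,_)
open import Data.Sign.Base as Sign using (Sign)
import Data.Sign.Properties as Sign
open import Data.Sum using (inj₁; inj₂)
open import Data.Vec using (Vec; []; _∷_; lookup; tabulate)
import Data.Vec as Vec
import Data.Vec.Properties as Vec
open import Function using (id; _∘_)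
open import Level using (0ℓ)
open import Relation.Binary.Definitions using (DecidableEquality)
open import Relation.Binary.PropositionalEquality
  using (_≡_; refl; sym; trans; cong; module ≡-Reasoning)
open import Relation.Nullary.Decidable using (True; toWitness; map′; _×-dec_)
open import Relation.Unary using (Pred; Decidable)
open ≡-Reasoning

module _ {A : Set} (ρ : Edge → A → A) where

  -- x_e⁻¹ acts like x_e: the square relators make every ρ e an involution.
  act : Word → A → A
  act []            = id
  act ((e , _) ∷ w) = ρ e ∘ act w

  act-++ : ∀ u v p → act (u ++ v) p ≡ act u (act v p)
  act-++ []            v p = refl
  act-++ ((e , _) ∷ u) v p = cong (ρ e) (act-++ u v p)

  act-resp-≈ : (∀ {r} → Relator r → ∀ p → act r p ≡ p) →
               ∀ {w w'} → w ≈ w' → ∀ p → act w p ≡ act w' p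
  act-resp-≈ triv ≈-refl               p = refl
  act-resp-≈ triv (≈-sym w≈w')         p = sym (act-resp-≈ triv w≈w' p)
  act-resp-≈ triv (≈-trans w≈w' w'≈w'') p =
    trans (act-resp-≈ triv w≈w' p) (act-resp-≈ triv w'≈w'' p)
  act-resp-≈ triv (cancel u (e , b) v) p = begin
    act (u ++ (e , b) ∷ invL (e , b) ∷ v) p  ≡⟨ act-++ u _ p ⟩
    act u (ρ e (ρ e (act v p)))              ≡⟨ cong (act u) (triv (square e) (act v p)) ⟩
    act u (act v p)                          ≡⟨ act-++ u v p ⟨
    act (u ++ v) p                           ∎
  act-resp-≈ triv (relator u r v R) p = begin
    act (u ++ r ++ v) p      ≡⟨ act-++ u (r ++ v) p ⟩
    act u (act (r ++ v) p)   ≡⟨ cong (act u) (act-++ r v p) ⟩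
    act u (act r (act v p))  ≡⟨ cong (act u) (triv R (act v p)) ⟩
    act u (act v p)          ≡⟨ act-++ u v p ⟨
    act (u ++ v) p           ∎

signed : Sign → ℤ → ℤ
signed Sign.+ x = x
signed Sign.- x = ℤ.- x

signed-* : ∀ s t x → signed s (signed t x) ≡ signed (s Sign.* t) x
signed-* Sign.+ t      x = refl
signed-* Sign.- Sign.+ x = refl
signed-* Sign.- Sign.- x = ℤ.neg-involutive x

signed-+ : ∀ s x y → signed s (x + y) ≡ signed s x + signed s y
signed-+ Sign.+ x y = refl
signed-+ Sign.- x y = ℤ.neg-distrib-+ x y

data Term (n : ℕ) : Set where
  term : Sign → Fin n → ℤ → Term n

Affine : ℕ → Set
Affine n = Vec (Term n) n

module _ {n : ℕ} where

  +x_ -x_ : Fin n → Term n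
  +x i = term Sign.+ i 0ℤ
  -x i = term Sign.- i 0ℤ

  infixl 7 _⊕_
  _⊕_ : Term n → ℤ → Term n
  term s i a ⊕ b = term s i (a + b)

  ⟦_⟧ₜ : Term n → Vec ℤ n → ℤ
  ⟦ term s i a ⟧ₜ p = signed s (lookup p i) + a

  ⟦_⟧ : Affine n → Vec ℤ n → Vec ℤ n
  ⟦ f ⟧ p = Vec.map (λ τ → ⟦ τ ⟧ₜ p) f

  idₐ : Affine n
  idₐ = tabulate +x_

  rescale : Sign → ℤ → Term n → Term n
  rescale s a (term t j b) = term (s Sign.* t) j (signed s b + a)

  infixr 9 _∘ₜ_ _∘ₐ_
  _∘ₜ_ : Term n → Affine n → Term n
  term s i a ∘ₜ g = rescale s a (lookup g i)

  _∘ₐ_ : Affine n → Affine n → Affine n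
  f ∘ₐ g = Vec.map (_∘ₜ g) f

  ⟦rescale⟧ : ∀ s a τ p → ⟦ rescale s a τ ⟧ₜ p ≡ signed s (⟦ τ ⟧ₜ p) + a
  ⟦rescale⟧ s a (term t j b) p = begin
    signed (s Sign.* t) xⱼ + (signed s b + a)  ≡⟨ cong (_+ _) (signed-* s t xⱼ) ⟨
    signed s (signed t xⱼ) + (signed s b + a)  ≡⟨ ℤ.+-assoc (signed s (signed t xⱼ)) (signed s b) a ⟨
    signed s (signed t xⱼ) + signed s b + a    ≡⟨ cong (_+ a) (signed-+ s (signed t xⱼ) b) ⟨
    signed s (signed t xⱼ + b) + a             ∎
    where xⱼ = lookup p j

  ⟦∘ₜ⟧ : ∀ τ g p → ⟦ τ ∘ₜ g ⟧ₜ p ≡ ⟦ τ ⟧ₜ (⟦ g ⟧ p)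
  ⟦∘ₜ⟧ (term s i a) g p = begin
    ⟦ rescale s a (lookup g i) ⟧ₜ p  ≡⟨ ⟦rescale⟧ s a (lookup g i) p ⟩
    signed s (⟦ lookup g i ⟧ₜ p) + a  ≡⟨ cong (λ y → signed s y + a) (Vec.lookup-map i _ g) ⟨
    signed s (lookup (⟦ g ⟧ p) i) + a ∎

  ⟦∘ₐ⟧ : ∀ f g p → ⟦ f ∘ₐ g ⟧ p ≡ ⟦ f ⟧ (⟦ g ⟧ p)
  ⟦∘ₐ⟧ f g p = begin
    Vec.map (λ τ → ⟦ τ ⟧ₜ p) (Vec.map (_∘ₜ g) f)  ≡⟨ Vec.map-∘ _ _ f ⟨
    Vec.map (λ τ → ⟦ τ ∘ₜ g ⟧ₜ p) f               ≡⟨ Vec.map-cong (λ τ → ⟦∘ₜ⟧ τ g p) f ⟩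
    ⟦ f ⟧ (⟦ g ⟧ p)                               ∎

  ⟦idₐ⟧ : ∀ p → ⟦ idₐ ⟧ p ≡ p
  ⟦idₐ⟧ p = begin
    Vec.map (λ τ → ⟦ τ ⟧ₜ p) (tabulate +x_)  ≡⟨ Vec.tabulate-∘ _ _ ⟨
    tabulate (λ i → lookup p i + 0ℤ)         ≡⟨ Vec.tabulate-cong (ℤ.+-identityʳ ∘ lookup p) ⟩
    tabulate (lookup p)                      ≡⟨ Vec.tabulate∘lookup p ⟩
    p                                        ∎

  term-≟ : DecidableEquality (Term n)
  term-≟ (term s i a) (term t j b) =
    map′ (λ { (refl , refl , refl) → refl }) (λ { refl → refl , refl , refl })
         (s Sign.≟ t ×-dec i Fin.≟ j ×-dec a ℤ.≟ b)

  affine-≟ : DecidableEquality (Affine n)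
  affine-≟ = Vec.≡-dec term-≟

  eval : (Edge → Affine n) → Word → Affine n
  eval ρ []            = idₐ
  eval ρ ((e , _) ∷ w) = ρ e ∘ₐ eval ρ w

  act-eval : ∀ ρ w p → act (⟦_⟧ ∘ ρ) w p ≡ ⟦ eval ρ w ⟧ p
  act-eval ρ []            p = sym (⟦idₐ⟧ p)
  act-eval ρ ((e , _) ∷ w) p = begin
    ⟦ ρ e ⟧ (act (⟦_⟧ ∘ ρ) w p)  ≡⟨ cong ⟦ ρ e ⟧ (act-eval ρ w p) ⟩
    ⟦ ρ e ⟧ (⟦ eval ρ w ⟧ p)     ≡⟨ ⟦∘ₐ⟧ (ρ e) (eval ρ w) p ⟨
    ⟦ ρ e ∘ₐ eval ρ w ⟧ p        ∎

all-by-computation : ∀ {n} {P : Pred (Fin n) 0ℓ} (P? : Decidable P) →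
                     {True (all? P?)} → ∀ i → P i
all-by-computation P? {ok} = toWitness ok

⟨_∣_∣_∣_⟩ : {A : Set} → A → A → A → A → Vec A 4
⟨ a ∣ b ∣ c ∣ d ⟩ = a ∷ b ∷ c ∷ d ∷ []

isometry : Fin 3 → Fin 3 → Affine 4
isometry 0F 0F = ⟨ -x 0F ⊕ -1ℤ ∣ +x 1F       ∣ -x 2F ⊕ 1ℤ ∣ +x 3F ⟩
isometry 0F 1F = ⟨ -x 2F       ∣ -x 3F       ∣ -x 0F      ∣ -x 1F ⟩
isometry 0F 2F = ⟨ -x 2F       ∣ +x 3F       ∣ -x 0F      ∣ +x 1F ⟩
isometry 1F 0F = ⟨ -x 0F ⊕ -1ℤ ∣ -x 1F ⊕ 1ℤ  ∣ +x 2F      ∣ +x 3F ⟩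
isometry 1F 1F = ⟨ -x 1F       ∣ -x 0F       ∣ -x 3F      ∣ -x 2F ⟩
isometry 1F 2F = ⟨ -x 1F       ∣ -x 0F       ∣ +x 3F      ∣ +x 2F ⟩
isometry 2F 0F = ⟨ +x 0F       ∣ -x 1F ⊕ 1ℤ  ∣ -x 2F ⊕ 1ℤ ∣ +x 3F ⟩
isometry 2F 1F = ⟨ +x 3F       ∣ +x 2F       ∣ +x 1F      ∣ +x 0F ⟩
isometry 2F 2F = ⟨ -x 3F       ∣ +x 2F       ∣ +x 1F      ∣ -x 0F ⟩

-- The right vertices are paired as {0,2}, {1,3}, {4,5}, and paired vertices get equal
-- generators, so each left-vertex relator becomes a product of three commuting squares.
column : Fin 6 → Fin 3
column 0F = 0F
column 1F = 1F
column 2F = 0F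
column 3F = 1F
column 4F = 2F
column 5F = 2F

edgeIsometry : Edge → Affine 4
edgeIsometry (i , j) = isometry i (column j)

Trivial : Word → Set
Trivial w = eval edgeIsometry w ≡ idₐ

trivial? : Decidable Trivial
trivial? w = affine-≟ (eval edgeIsometry w) idₐ

square-trivial : ∀ e → Trivial (gen e ∷ gen e ∷ [])
square-trivial (i , j) =
  all-by-computation (λ i → all? λ j → trivial? (gen (i , j) ∷ gen (i , j) ∷ [])) i j

vertex-trivial : ∀ v → Trivial (map gen (edgesAt v))
vertex-trivial (inj₁ i) = all-by-computation (λ i → trivial? (map gen (edgesAt (inj₁ i)))) i
vertex-trivial (inj₂ j) = all-by-computation (λ j → trivial? (map gen (edgesAt (inj₂ j)))) j

commutator : Edge → Edge → Word
commutator e e' = gen e ∷ gen e' ∷ inv e ∷ inv e' ∷ []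

CommutatorsTrivialAt : Vertex → Set
CommutatorsTrivialAt v =
  All (λ e → All (λ e' → Trivial (commutator e e')) (edgesAt v)) (edgesAt v)

commutatorsTrivialAt? : Decidable CommutatorsTrivialAt
commutatorsTrivialAt? v =
  All.all? (λ e → All.all? (λ e' → trivial? (commutator e e')) (edgesAt v)) (edgesAt v)

commutators-trivial : ∀ v → CommutatorsTrivialAt v
commutators-trivial (inj₁ i) = all-by-computation (commutatorsTrivialAt? ∘ inj₁) i
commutators-trivial (inj₂ j) = all-by-computation (commutatorsTrivialAt? ∘ inj₂) j

relator-trivial : ∀ {r} → Relator r → Trivial r
relator-trivial (square e)            = square-trivial e
relator-trivial (commute v e e' m m') = All.lookup (All.lookup (commutators-trivial v) m) m'
relator-trivial (vertex v)            = vertex-trivial v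

action : Word → Vec ℤ 4 → Vec ℤ 4
action = act (⟦_⟧ ∘ edgeIsometry)

action-eval : ∀ w p → action w p ≡ ⟦ eval edgeIsometry w ⟧ p
action-eval = act-eval edgeIsometry

action-resp-≈ : ∀ {w w'} → w ≈ w' → ∀ p → action w p ≡ action w' p
action-resp-≈ = act-resp-≈ (⟦_⟧ ∘ edgeIsometry) relator-acts-trivially
  where
  relator-acts-trivially : ∀ {r} → Relator r → ∀ p → action r p ≡ p
  relator-acts-trivially {r} R p = begin
    action r p                  ≡⟨ action-eval r p ⟩
    ⟦ eval edgeIsometry r ⟧ p   ≡⟨ cong (λ f → ⟦ f ⟧ p) (relator-trivial R) ⟩
    ⟦ idₐ ⟧ p                   ≡⟨ ⟦idₐ⟧ p ⟩
    p                           ∎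

h : Word
h = gen (0F , 0F) ∷ gen (1F , 1F) ∷ gen (0F , 4F) ∷ gen (2F , 1F) ∷ []

h-is-translation : eval edgeIsometry h ≡ ⟨ +x 0F ⊕ -1ℤ ∣ +x 1F ∣ +x 2F ⊕ 1ℤ ∣ +x 3F ⟩
h-is-translation = refl

infixr 8 _^_
_^_ : Word → ℕ → Word
w ^ zero  = []
w ^ suc n = w ++ w ^ n

third : Vec ℤ 4 → ℤ
third p = lookup p 2F

origin : Vec ℤ 4
origin = ⟨ 0ℤ ∣ 0ℤ ∣ 0ℤ ∣ 0ℤ ⟩

h-shifts-third : ∀ p → third (action h p) ≡ third p + 1ℤ
h-shifts-third p = cong third (begin
  action h p                                         ≡⟨ action-eval h p ⟩
  ⟦ eval edgeIsometry h ⟧ p                          ≡⟨ cong (λ f → ⟦ f ⟧ p) h-is-translation ⟩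
  ⟦ ⟨ +x 0F ⊕ -1ℤ ∣ +x 1F ∣ +x 2F ⊕ 1ℤ ∣ +x 3F ⟩ ⟧ p  ∎)

third-hⁿ : ∀ n → third (action (h ^ n) origin) ≡ ℤ.+ n
third-hⁿ zero    = refl
third-hⁿ (suc n) = begin
  third (action (h ++ h ^ n) origin)        ≡⟨ cong third (act-++ (⟦_⟧ ∘ edgeIsometry) h (h ^ n) origin) ⟩
  third (action h (action (h ^ n) origin))  ≡⟨ h-shifts-third (action (h ^ n) origin) ⟩
  third (action (h ^ n) origin) + 1ℤ        ≡⟨ cong (_+ 1ℤ) (third-hⁿ n) ⟩
  ℤ.+ n + 1ℤ                                ≡⟨ cong ℤ.+_ (ℕ.+-comm n 1) ⟩
  ℤ.+ suc n                                 ∎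

proposition5p24 : Σ (ℕ → Word) λ f → ∀ m n → f m ≈ f n → m ≡ n
proposition5p24 = h ^_ , λ m n hᵐ≈hⁿ → ℤ.+-injective (begin
  ℤ.+ m                          ≡⟨ third-hⁿ m ⟨
  third (action (h ^ m) origin)  ≡⟨ cong third (action-resp-≈ hᵐ≈hⁿ origin) ⟩
  third (action (h ^ n) origin)  ≡⟨ third-hⁿ n ⟩
  ℤ.+ n                          ∎)
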